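{- Let $\mathcal{A}$ and $\mathcal{B}$ be pattern classes and let $\mathcal{R}=\{1,12,21,132,213,231,312,2413,3142\}$. If $f:\mathcal{A}\to\mathcal{B}$ and $g:\mathcal{A}\to\mathcal{B}$ are poset isomorphisms with $f|_{\mathcal{R}\cap\mathcal{A}}=g|_{\mathcal{R}\cap\mathcal{A}}$, then $f=g$.
   Context: Permutations are finite, in one-line notation, partially ordered by pattern containment ($\sigma\le\pi$ if $\pi$ has a subsequence order-isomorphic to $\sigma$). A pattern class is a down-set of this poset. Isomorphisms are with respect to the containment order. -}

module Defs where

open import Data.Nat using (ℕ; suc; _<_)
open import Data.List using (List; []; _∷_; map; upTo; length)
open import Data.List.Relation.Binary.Permutation.Propositional using (_↭_)
open import Data.List.Relation.Binary.Sublist.Propositional using (_⊆_)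
open import Data.List.Relation.Binary.Pointwise using (Pointwise)
open import Data.List.Membership.Propositional using (_∈_)
open import Data.Product using (Σ; _×_; ∃)
open import Data.Unit using (⊤)
open import Data.Empty using (⊥)
open import Function.Bundles using (_⇔_)
open import Relation.Binary.PropositionalEquality using (_≡_)

-- A (finite) permutation in one-line notation: a list of naturals that is a
-- rearrangement of 1,2,…,n where n is its length (n = 0 allowed: empty perm).
record Perm : Set where
  constructor mkPerm
  field
    entries : List ℕ
    isPerm  : entries ↭ map suc (upTo (length entries))
open Perm public

OrdIso : List ℕ → List ℕ → Set
OrdIso [] [] = ⊤
OrdIso [] (_ ∷ _) = ⊥
OrdIso (_ ∷ _) [] = ⊥
OrdIso (x ∷ xs) (y ∷ ys) =
  Pointwise (λ x′ y′ → ((x < x′) ⇔ (y < y′)) × ((x′ < x) ⇔ (y′ < y))) xs ys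
  × OrdIso xs ys

_≼_ : Perm → Perm → Set
σ ≼ π = Σ (List ℕ) (λ ys → (ys ⊆ entries π) × OrdIso (entries σ) ys)

IsPatternClass : (Perm → Set) → Set
IsPatternClass C = ∀ σ π → σ ≼ π → C π → C σ

-- A poset isomorphism between pattern classes A and B (as subposets).
-- Permutations are compared by their entries.
record PosetIso (A B : Perm → Set) : Set where
  field
    fun     : (π : Perm) → A π → Perm
    fun∈    : ∀ π (a : A π) → B (fun π a)
    order   : ∀ σ π (a : A σ) (b : A π) → ((σ ≼ π) ⇔ (fun σ a ≼ fun π b))
    surject : ∀ τ → B τ → ∃ λ π → Σ (A π) λ a → entries (fun π a) ≡ entries τ
open PosetIso public

Rlist : List (List ℕ)
Rlist = (1 ∷ []) ∷ (1 ∷ 2 ∷ []) ∷ (2 ∷ 1 ∷ []) ∷ (1 ∷ 3 ∷ 2 ∷ []) ∷ (2 ∷ 1 ∷ 3 ∷ [])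
      ∷ (2 ∷ 3 ∷ 1 ∷ []) ∷ (3 ∷ 1 ∷ 2 ∷ []) ∷ (2 ∷ 4 ∷ 1 ∷ 3 ∷ [])
      ∷ (3 ∷ 1 ∷ 4 ∷ 2 ∷ []) ∷ []

InR : Perm → Set
InR π = entries π ∈ Rlist

-- A poset isomorphism between pattern classes preserves size: it sends a proper
-- pattern of π to a proper pattern of the image of π, so sizes can only grow, and the
-- same holds for its inverse.  Now induct on size.  If f and g agree below π ∉ R, take
-- π′ with g π′ = f π; then π and π′ have the same size and, since f and g agree on
-- smaller permutations, the same deck (set of patterns one entry shorter).  Every
-- permutation outside R is determined by its deck: up to size 5 by exhaustive
-- computation, and beyond that because the deck of π determines the decks, hence by
-- induction the permutations, obtained by deleting its first, its last and its largest
-- entry.  These three determine π: every pair of entries other than the first and the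
-- last survives an end deletion, and that pair survives the deletion of the largest
-- entry unless one of them is the largest, in which case the deletions force the
-- largest entry of π′ to the same end.  So π = π′ and g π = g π′ = f π.

module Submission where

open import Defs
open import Data.Nat using (ℕ; zero; suc; _+_; _∸_; _⊔_; _<_; _≤_; s≤s; z≤n; _≟_)
open import Data.Bool using (Bool)
import Data.Bool as Bool
open import Data.Empty using (⊥-elim)
open import Data.List using (List; []; _∷_; length; zip; _++_; map; concatMap; upTo; take; drop; initLast; _∷ʳ′_)
open import Data.List.Properties
  using (length-++; length-++-sucʳ; length-++-≤ˡ; length-map; length-upTo; length-take; map-++; map-cong-local;
         upTo-∷ʳ; take++drop≡id; ≡-dec)
open import Data.List.Membership.Propositional using (_∈_; _∉_; find; lose)
open import Data.List.Membership.Propositional.Properties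
  using (∈-++⁻; ∈-++⁺ˡ; ∈-++⁺ʳ; ∈-map⁺; ∈-map⁻; ∈-upTo⁻; ∈-∃++; ∈-concatMap⁺; ∈-concatMap⁻)
open import Data.List.Membership.DecPropositional _≟_ using (_∈?_)
open import Data.List.Membership.DecPropositional (≡-dec _≟_) using () renaming (_∈?_ to _∈ₗ?_)
open import Data.List.Relation.Binary.Equality.Propositional using (≋⇒≡)
import Data.List.Relation.Binary.Permutation.Propositional as ↭
open ↭ using (_↭_; prep; swap; ↭-refl; ↭-sym; ↭-trans; module PermutationReasoning)
open import Data.List.Relation.Binary.Permutation.Propositional.Properties
  using (∈-resp-↭; drop-∷; drop-mid; shift; ∷↭∷ʳ; ↭-length; ↭-empty-inv) renaming (map⁺ to ↭-map⁺)
open import Data.List.Relation.Binary.Pointwise as Pointwise using (Pointwise; []; _∷_)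
open import Data.List.Relation.Binary.Sublist.Propositional
  using (_⊆_; []; _∷_; _∷ʳ_; lookup; ⊆-refl; ⊆-trans; minimum)
open import Data.List.Relation.Binary.Sublist.Propositional.Properties using (drop-⊆; drop⁺; length-mono-≤; to-≋)
open import Data.List.Relation.Unary.All as All using (All; []; _∷_; all?)
import Data.List.Relation.Unary.All.Properties as All
open import Data.List.Relation.Unary.All.Properties using (All¬⇒¬Any)
open import Data.List.Relation.Unary.AllPairs using ([]; _∷_)
open import Data.List.Relation.Unary.Any using (here; there)
open import Data.List.Relation.Unary.Unique.Propositional using (Unique)
import Data.List.Relation.Unary.Unique.Propositional.Properties as Unique
open import Data.Nat.Induction using (<-rec)
open import Data.Nat.ListAction using (sum)
open import Data.Nat.ListAction.Properties using (sum-↭)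
open import Data.Nat.Properties
open import Data.Product using (Σ; _×_; _,_; proj₁; proj₂)
open import Data.Sum using (_⊎_; inj₁; inj₂)
open import Data.Unit using (⊤; tt)
open import Function using (_∘_; id)
open import Function.Bundles using (_⇔_; mk⇔; Equivalence)
open import Function.Construct.Composition using (_⇔-∘_)
open import Function.Construct.Symmetry using (⇔-sym)
open import Relation.Binary.Definitions using (tri<; tri≈; tri>)
open import Relation.Binary.PropositionalEquality
  using (_≡_; _≢_; refl; sym; trans; cong; cong₂; subst; subst₂; module ≡-Reasoning)
open import Relation.Nullary using (Dec; yes; no; does; ¬_; ¬?)
open import Relation.Nullary.Decidable using (map′; _×-dec_; _⊎-dec_; _→-dec_; from-yes; does-⇔)

-- Order-isomorphism of sequences

SameOrder : ℕ × ℕ → ℕ × ℕ → Set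
SameOrder (a , b) (c , d) = (a < c) ⇔ (b < d)

SameOrder-refl : ∀ p → SameOrder p p
SameOrder-refl (a , b) = mk⇔ (λ a<a → ⊥-elim (<-irrefl refl a<a)) (λ b<b → ⊥-elim (<-irrefl refl b<b))

Coherent : List (ℕ × ℕ) → Set
Coherent ps = ∀ {p q} → p ∈ ps → q ∈ ps → SameOrder p q

Coherent-⊆ : ∀ {ps qs} → qs ⊆ ps → Coherent ps → Coherent qs
Coherent-⊆ qs⊆ps coh p∈ q∈ = coh (lookup qs⊆ps p∈) (lookup qs⊆ps q∈)

zip-++ : ∀ (as bs cs ds : List ℕ) → length as ≡ length cs → zip (as ++ bs) (cs ++ ds) ≡ zip as cs ++ zip bs ds
zip-++ [] _ [] _ _ = refl
zip-++ (a ∷ as) bs (c ∷ cs) ds e = cong ((a , c) ∷_) (zip-++ as bs cs ds (suc-injective e))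

∈-zip⇒∈ˡ : ∀ {a b} (xs ys : List ℕ) → (a , b) ∈ zip xs ys → a ∈ xs
∈-zip⇒∈ˡ (_ ∷ _) (_ ∷ _) (here refl) = here refl
∈-zip⇒∈ˡ (_ ∷ xs) (_ ∷ ys) (there m) = there (∈-zip⇒∈ˡ xs ys m)

∈-zip⇒∈ʳ : ∀ {a b} (xs ys : List ℕ) → (a , b) ∈ zip xs ys → b ∈ ys
∈-zip⇒∈ʳ (_ ∷ _) (_ ∷ _) (here refl) = here refl
∈-zip⇒∈ʳ (_ ∷ xs) (_ ∷ ys) (there m) = there (∈-zip⇒∈ʳ xs ys m)

partnerʳ : ∀ {a} (xs ys : List ℕ) → length xs ≡ length ys → a ∈ xs → Σ ℕ λ b → (a , b) ∈ zip xs ys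
partnerʳ (_ ∷ _) (y ∷ _) _ (here refl) = y , here refl
partnerʳ (_ ∷ xs) (_ ∷ ys) e (there m) = let b , m′ = partnerʳ xs ys (suc-injective e) m in b , there m′

partnerˡ : ∀ {b} (xs ys : List ℕ) → length xs ≡ length ys → b ∈ ys → Σ ℕ λ a → (a , b) ∈ zip xs ys
partnerˡ (x ∷ _) (_ ∷ _) _ (here refl) = x , here refl
partnerˡ (_ ∷ xs) (_ ∷ ys) e (there m) = let a , m′ = partnerˡ xs ys (suc-injective e) m in a , there m′

-- Unlike OrdIso, this formulation is inherited by any sublist of the zipped pairs.
infix 4 _≅_
_≅_ : List ℕ → List ℕ → Set
xs ≅ ys = length xs ≡ length ys × Coherent (zip xs ys)

private
  Agree : ℕ → ℕ → ℕ → ℕ → Set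
  Agree x y x′ y′ = SameOrder (x , y) (x′ , y′) × SameOrder (x′ , y′) (x , y)

  Pointwise⇒∈-zip : ∀ {x y xs ys} → Pointwise (Agree x y) xs ys → ∀ {a b} → (a , b) ∈ zip xs ys → Agree x y a b
  Pointwise⇒∈-zip (r ∷ _) (here refl) = r
  Pointwise⇒∈-zip (_ ∷ rs) (there m) = Pointwise⇒∈-zip rs m

  ∈-zip⇒Pointwise : ∀ {x y} (xs ys : List ℕ) → length xs ≡ length ys →
    (∀ {a b} → (a , b) ∈ zip xs ys → Agree x y a b) → Pointwise (Agree x y) xs ys
  ∈-zip⇒Pointwise [] [] _ _ = []
  ∈-zip⇒Pointwise (_ ∷ xs) (_ ∷ ys) e f = f (here refl) ∷ ∈-zip⇒Pointwise xs ys (suc-injective e) (f ∘ there)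

OrdIso⇒≅ : ∀ (xs ys : List ℕ) → OrdIso xs ys → xs ≅ ys
OrdIso⇒≅ [] [] _ = refl , λ ()
OrdIso⇒≅ (x ∷ xs) (y ∷ ys) (pw , iso) = cong suc (proj₁ ih) , coh
  where
  ih = OrdIso⇒≅ xs ys iso
  coh : Coherent ((x , y) ∷ zip xs ys)
  coh (here refl) (here refl) = SameOrder-refl _
  coh (here refl) (there q) = proj₁ (Pointwise⇒∈-zip pw q)
  coh (there p) (here refl) = proj₂ (Pointwise⇒∈-zip pw p)
  coh (there p) (there q) = proj₂ ih p q

≅⇒OrdIso : ∀ (xs ys : List ℕ) → xs ≅ ys → OrdIso xs ys
≅⇒OrdIso [] [] _ = tt
≅⇒OrdIso (x ∷ xs) (y ∷ ys) (e , coh) =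
  ∈-zip⇒Pointwise xs ys (suc-injective e) (λ m → coh (here refl) (there m) , coh (there m) (here refl)) ,
  ≅⇒OrdIso xs ys (suc-injective e , λ p q → coh (there p) (there q))

private
  ∈-zip-swap : ∀ {a b : ℕ} (xs ys : List ℕ) → (a , b) ∈ zip xs ys → (b , a) ∈ zip ys xs
  ∈-zip-swap (_ ∷ _) (_ ∷ _) (here refl) = here refl
  ∈-zip-swap (_ ∷ xs) (_ ∷ ys) (there m) = there (∈-zip-swap xs ys m)

  ∈-zip-diagonal : ∀ {p} (xs : List ℕ) → p ∈ zip xs xs → proj₁ p ≡ proj₂ p
  ∈-zip-diagonal (_ ∷ _) (here refl) = refl
  ∈-zip-diagonal (_ ∷ xs) (there m) = ∈-zip-diagonal xs m

  ∈-zip-through : ∀ {a c : ℕ} (xs ys zs : List ℕ) → length xs ≡ length ys → (a , c) ∈ zip xs zs →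
    Σ ℕ λ b → (a , b) ∈ zip xs ys × (b , c) ∈ zip ys zs
  ∈-zip-through (_ ∷ _) (y ∷ _) (_ ∷ _) _ (here refl) = y , here refl , here refl
  ∈-zip-through (_ ∷ xs) (_ ∷ ys) (_ ∷ zs) e (there m) with ∈-zip-through xs ys zs (suc-injective e) m
  ... | b , m₁ , m₂ = b , there m₁ , there m₂

≅-refl : ∀ xs → xs ≅ xs
≅-refl xs = refl , coh
  where
  coh : Coherent (zip xs xs)
  coh {p} {q} p∈ q∈ = diagonal p q (∈-zip-diagonal xs p∈) (∈-zip-diagonal xs q∈)
    where
    diagonal : ∀ p q → proj₁ p ≡ proj₂ p → proj₁ q ≡ proj₂ q → SameOrder p q
    diagonal (a , .a) (c , .c) refl refl = mk⇔ id id

≅-sym : ∀ {xs ys} → xs ≅ ys → ys ≅ xs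
≅-sym {xs} {ys} (e , coh) = sym e , coh′
  where
  coh′ : Coherent (zip ys xs)
  coh′ {_ , _} {_ , _} p q = ⇔-sym (coh (∈-zip-swap ys xs p) (∈-zip-swap ys xs q))

≅-trans : ∀ {xs ys zs} → xs ≅ ys → ys ≅ zs → xs ≅ zs
≅-trans {xs} {ys} {zs} (e₁ , coh₁) (e₂ , coh₂) = trans e₁ e₂ , coh
  where
  coh : Coherent (zip xs zs)
  coh {_ , _} {_ , _} p q =
    let _ , p₁ , p₂ = ∈-zip-through xs ys zs e₁ p
        _ , q₁ , q₂ = ∈-zip-through xs ys zs e₁ q
    in coh₂ p₂ q₂ ⇔-∘ coh₁ p₁ q₁

private
  ⊆-align : ∀ {zs xs : List ℕ} (ys : List ℕ) → length xs ≡ length ys → zs ⊆ xs →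
    Σ (List ℕ) λ ws → ws ⊆ ys × length zs ≡ length ws × zip zs ws ⊆ zip xs ys
  ⊆-align [] _ [] = [] , [] , refl , []
  ⊆-align (y ∷ ys) e (_ ∷ʳ s) =
    let ws , ws⊆ys , len , pairs⊆ = ⊆-align ys (suc-injective e) s
    in ws , y ∷ʳ ws⊆ys , len , _ ∷ʳ pairs⊆
  ⊆-align (y ∷ ys) e (refl ∷ s) =
    let ws , ws⊆ys , len , pairs⊆ = ⊆-align ys (suc-injective e) s
    in y ∷ ws , refl ∷ ws⊆ys , cong suc len , refl ∷ pairs⊆

≅-restrict : ∀ {zs xs ys : List ℕ} → xs ≅ ys → zs ⊆ xs → Σ (List ℕ) λ ws → ws ⊆ ys × zs ≅ ws
≅-restrict {ys = ys} (e , coh) zs⊆xs =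
  let ws , ws⊆ys , len , pairs⊆ = ⊆-align ys e zs⊆xs
  in ws , ws⊆ys , len , Coherent-⊆ pairs⊆ coh

Occurs : List ℕ → List ℕ → Set
Occurs zs xs = Σ (List ℕ) λ ws → ws ⊆ xs × zs ≅ ws

Occurs-resp-≅ : ∀ {zs xs ys} → Occurs zs xs → xs ≅ ys → Occurs zs ys
Occurs-resp-≅ (ws , ws⊆xs , zs≅ws) xs≅ys =
  let vs , vs⊆ys , ws≅vs = ≅-restrict xs≅ys ws⊆xs
  in vs , vs⊆ys , ≅-trans zs≅ws ws≅vs

Distinct : List ℕ → Set
Distinct [] = ⊤
Distinct (x ∷ xs) = x ∉ xs × Distinct xs

Distinct-⊆ : ∀ {xs ys : List ℕ} → xs ⊆ ys → Distinct ys → Distinct xs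
Distinct-⊆ [] _ = tt
Distinct-⊆ (_ ∷ʳ s) (_ , d) = Distinct-⊆ s d
Distinct-⊆ (refl ∷ s) (x∉ , d) = (λ x∈ → x∉ (lookup s x∈)) , Distinct-⊆ s d

Distinct-∉-last : ∀ (xs : List ℕ) z → Distinct (xs ++ z ∷ []) → z ∉ xs
Distinct-∉-last (_ ∷ xs) z (x∉ , _) (here refl) = x∉ (∈-++⁺ʳ xs (here refl))
Distinct-∉-last (_ ∷ xs) z (_ , d) (there z∈) = Distinct-∉-last xs z d z∈

maximum : List ℕ → ℕ
maximum [] = 0
maximum (x ∷ xs) = x ⊔ maximum xs

≤-maximum : ∀ xs → All (_≤ maximum xs) xs
≤-maximum [] = []
≤-maximum (x ∷ xs) = m≤m⊔n x (maximum xs) ∷ All.map (λ h → ≤-trans h (m≤n⊔m x (maximum xs))) (≤-maximum xs)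

maximum-least : ∀ {b} xs → All (_≤ b) xs → maximum xs ≤ b
maximum-least [] [] = z≤n
maximum-least (_ ∷ xs) (h ∷ hs) = ⊔-lub h (maximum-least xs hs)

maximum-∈ : ∀ x xs → maximum (x ∷ xs) ∈ x ∷ xs
maximum-∈ x [] rewrite ⊔-identityʳ x = here refl
maximum-∈ x (y ∷ xs) with ≤-total x (maximum (y ∷ xs))
... | inj₁ x≤ rewrite m≤n⇒m⊔n≡n x≤ = there (maximum-∈ y xs)
... | inj₂ ≤x rewrite m≥n⇒m⊔n≡m ≤x = here refl

maximum-unique : ∀ {m} xs → m ∈ xs → All (_≤ m) xs → maximum xs ≡ m
maximum-unique xs m∈ ≤m = ≤-antisym (maximum-least xs ≤m) (All.lookup (≤-maximum xs) m∈)

maximum-mono-⊆ : ∀ {xs ys : List ℕ} → xs ⊆ ys → maximum xs ≤ maximum ys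
maximum-mono-⊆ {xs} {ys} s = maximum-least xs (All.tabulate (λ x∈ → All.lookup (≤-maximum ys) (lookup s x∈)))

delete : ℕ → List ℕ → List ℕ
delete m [] = []
delete m (x ∷ xs) with x ≟ m
... | yes _ = xs
... | no _ = x ∷ delete m xs

delete-⊆ : ∀ m xs → delete m xs ⊆ xs
delete-⊆ m [] = []
delete-⊆ m (x ∷ xs) with x ≟ m
... | yes _ = x ∷ʳ ⊆-refl
... | no _ = refl ∷ delete-⊆ m xs

delete-head : ∀ m xs → delete m (m ∷ xs) ≡ xs
delete-head m xs with m ≟ m
... | yes _ = refl
... | no m≢m = ⊥-elim (m≢m refl)

delete-cons : ∀ m x xs → x ≢ m → delete m (x ∷ xs) ≡ x ∷ delete m xs
delete-cons m x xs x≢m with x ≟ m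
... | yes x≡m = ⊥-elim (x≢m x≡m)
... | no _ = refl

delete-∉ : ∀ m xs → m ∉ xs → delete m xs ≡ xs
delete-∉ m [] _ = refl
delete-∉ m (x ∷ xs) m∉ =
  trans (delete-cons m x xs (λ x≡m → m∉ (here (sym x≡m)))) (cong (x ∷_) (delete-∉ m xs (m∉ ∘ there)))

delete-mono : ∀ m {xs ys : List ℕ} → xs ⊆ ys → delete m xs ⊆ delete m ys
delete-mono m [] = []
delete-mono m {xs} (y ∷ʳ s) with y ≟ m
... | yes _ = ⊆-trans (delete-⊆ m xs) s
... | no _ = y ∷ʳ delete-mono m s
delete-mono m (_∷_ {x = y} refl s) with y ≟ m
... | yes _ = s
... | no _ = refl ∷ delete-mono m s

length-delete : ∀ m xs → m ∈ xs → suc (length (delete m xs)) ≡ length xs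
length-delete m (x ∷ xs) m∈ with x ≟ m
... | yes _ = refl
length-delete m (x ∷ xs) (here refl) | no x≢m = ⊥-elim (x≢m refl)
length-delete m (x ∷ xs) (there m∈) | no _ = cong suc (length-delete m xs m∈)

delete-++ˡ : ∀ m xs ys → m ∈ xs → delete m (xs ++ ys) ≡ delete m xs ++ ys
delete-++ˡ m (x ∷ xs) ys m∈ with x ≟ m
... | yes _ = refl
delete-++ˡ m (x ∷ xs) ys (here refl) | no x≢m = ⊥-elim (x≢m refl)
delete-++ˡ m (x ∷ xs) ys (there m∈) | no _ = cong (x ∷_) (delete-++ˡ m xs ys m∈)

delete-last : ∀ m xs → m ∉ xs → delete m (xs ++ m ∷ []) ≡ xs
delete-last m [] _ = delete-head m []
delete-last m (x ∷ xs) m∉ =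
  trans (delete-cons m x (xs ++ m ∷ []) (λ x≡m → m∉ (here (sym x≡m)))) (cong (x ∷_) (delete-last m xs (m∉ ∘ there)))

delete-lift : ∀ m xs {zs} → m ∈ xs → zs ⊆ delete m xs →
  Σ (List ℕ) λ ys → ys ⊆ xs × m ∈ ys × delete m ys ≡ zs × length ys ≡ suc (length zs)
delete-lift m (x ∷ xs) {zs} m∈ s with x ≟ m
... | yes refl = m ∷ zs , refl ∷ s , here refl , delete-head m zs , refl
delete-lift m (x ∷ xs) (here refl) s | no x≢m = ⊥-elim (x≢m refl)
delete-lift m (x ∷ xs) (there m∈) (.x ∷ʳ s) | no _ =
  let ys , ys⊆ , m∈ys , del , len = delete-lift m xs m∈ s
  in ys , x ∷ʳ ys⊆ , m∈ys , del , len
delete-lift m (x ∷ xs) (there m∈) (refl ∷ s) | no x≢m =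
  let ys , ys⊆ , m∈ys , del , len = delete-lift m xs m∈ s
  in x ∷ ys , refl ∷ ys⊆ , there m∈ys , trans (delete-cons m x ys x≢m) (cong (x ∷_) del) , cong suc len

zip-delete : ∀ {a b} (xs ys : List ℕ) → Distinct xs → Distinct ys → (a , b) ∈ zip xs ys →
  zip (delete a xs) (delete b ys) ⊆ zip xs ys
zip-delete (x ∷ xs) (y ∷ ys) _ _ (here refl) rewrite delete-head x xs | delete-head y ys = (x , y) ∷ʳ ⊆-refl
zip-delete {a} {b} (x ∷ xs) (y ∷ ys) (x∉ , dxs) (y∉ , dys) (there m)
  rewrite delete-cons a x xs (λ { refl → x∉ (∈-zip⇒∈ˡ xs ys m) })
        | delete-cons b y ys (λ { refl → y∉ (∈-zip⇒∈ʳ xs ys m) })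
  = refl ∷ zip-delete xs ys dxs dys m

-- Deleting the first, the last, or the largest entry

record EntryDeletion : Set where
  field
    del        : List ℕ → List ℕ
    del-⊆      : ∀ xs → del xs ⊆ xs
    del-mono   : ∀ {xs ys} → xs ⊆ ys → del xs ⊆ del ys
    del-≅      : ∀ {xs ys} → Distinct xs → Distinct ys → xs ≅ ys → del xs ≅ del ys
    length-del : ∀ x xs → suc (length (del (x ∷ xs))) ≡ length (x ∷ xs)
    del-lift   : ∀ x xs {zs} → zs ⊆ del (x ∷ xs) →
                 Σ (List ℕ) λ ys → ys ⊆ x ∷ xs × del ys ≡ zs × length ys ≡ suc (length zs)

firstEntry : EntryDeletion
firstEntry = record
  { del        = drop 1
  ; del-⊆      = drop-⊆ 1
  ; del-mono   = drop⁺ {m = 1} {n = 1} ≤-refl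
  ; del-≅      = λ _ _ → drop1-≅
  ; length-del = λ _ _ → refl
  ; del-lift   = λ x _ {zs} s → x ∷ zs , refl ∷ s , refl , refl
  }
  where
  drop1-≅ : ∀ {xs ys} → xs ≅ ys → drop 1 xs ≅ drop 1 ys
  drop1-≅ {[]} {[]} _ = refl , λ ()
  drop1-≅ {_ ∷ _} {_ ∷ _} (e , coh) = suc-injective e , λ p q → coh (there p) (there q)

dropLast : List ℕ → List ℕ
dropLast [] = []
dropLast (_ ∷ []) = []
dropLast (x ∷ y ∷ xs) = x ∷ dropLast (y ∷ xs)

dropLast-snoc : ∀ xs z → dropLast (xs ++ z ∷ []) ≡ xs
dropLast-snoc [] _ = refl
dropLast-snoc (_ ∷ []) _ = refl
dropLast-snoc (x ∷ y ∷ xs) z = cong (x ∷_) (dropLast-snoc (y ∷ xs) z)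

length-dropLast : ∀ xs → length (dropLast xs) ≡ length xs ∸ 1
length-dropLast [] = refl
length-dropLast (_ ∷ []) = refl
length-dropLast (_ ∷ y ∷ xs) = cong suc (length-dropLast (y ∷ xs))

dropLast-⊆ : ∀ xs → dropLast xs ⊆ xs
dropLast-⊆ [] = []
dropLast-⊆ (x ∷ []) = x ∷ʳ []
dropLast-⊆ (_ ∷ y ∷ xs) = refl ∷ dropLast-⊆ (y ∷ xs)

dropLast-mono : ∀ {xs ys} → xs ⊆ ys → dropLast xs ⊆ dropLast ys
dropLast-mono [] = []
dropLast-mono (_ ∷ʳ []) = []
dropLast-mono (y ∷ʳ s@(_ ∷ʳ _)) = y ∷ʳ dropLast-mono s
dropLast-mono (y ∷ʳ s@(_ ∷ _)) = y ∷ʳ dropLast-mono s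
dropLast-mono (refl ∷ []) = []
dropLast-mono (_∷_ {xs = []} refl (_ ∷ʳ _)) = minimum _
dropLast-mono (_∷_ {xs = _ ∷ _} refl s@(_ ∷ʳ _)) = refl ∷ dropLast-mono s
dropLast-mono (refl ∷ s@(refl ∷ _)) = refl ∷ dropLast-mono s

zip-dropLast : ∀ (xs ys : List ℕ) → zip (dropLast xs) (dropLast ys) ⊆ zip xs ys
zip-dropLast [] _ = []
zip-dropLast (_ ∷ []) _ = minimum _
zip-dropLast (_ ∷ _ ∷ _) [] = []
zip-dropLast (x ∷ _ ∷ _) (y ∷ []) = (x , y) ∷ʳ []
zip-dropLast (_ ∷ x′ ∷ xs) (_ ∷ y′ ∷ ys) = refl ∷ zip-dropLast (x′ ∷ xs) (y′ ∷ ys)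

dropLast-lift : ∀ x xs {zs} → zs ⊆ dropLast (x ∷ xs) →
  Σ (List ℕ) λ ys → ys ⊆ x ∷ xs × dropLast ys ≡ zs × length ys ≡ suc (length zs)
dropLast-lift x [] [] = x ∷ [] , refl ∷ [] , refl , refl
dropLast-lift x (y ∷ xs) (.x ∷ʳ s) =
  let ys , ys⊆ , del , len = dropLast-lift y xs s in ys , x ∷ʳ ys⊆ , del , len
dropLast-lift x (y ∷ xs) (refl ∷ s) with dropLast-lift y xs s
... | u ∷ ys , ys⊆ , del , len = x ∷ u ∷ ys , refl ∷ ys⊆ , cong (x ∷_) del , cong suc len

lastEntry : EntryDeletion
lastEntry = record
  { del        = dropLast
  ; del-⊆      = dropLast-⊆
  ; del-mono   = dropLast-mono
  ; del-≅      = λ {xs} {ys} _ _ (e , coh) →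
                   trans (length-dropLast xs) (trans (cong (_∸ 1) e) (sym (length-dropLast ys))) ,
                   Coherent-⊆ (zip-dropLast xs ys) coh
  ; length-del = λ x xs → cong suc (length-dropLast (x ∷ xs))
  ; del-lift   = dropLast-lift
  }

dropMax : List ℕ → List ℕ
dropMax xs = delete (maximum xs) xs

-- Under an order-isomorphism the maximum of xs is paired with the maximum of ys.
dropMax-≅ : ∀ {xs ys} → Distinct xs → Distinct ys → xs ≅ ys → dropMax xs ≅ dropMax ys
dropMax-≅ {[]} {[]} _ _ _ = refl , λ ()
dropMax-≅ {x ∷ xs} {ys} dxs dys (e , coh) =
  lengths , Coherent-⊆ (zip-delete (x ∷ xs) ys dxs dys max↦max) coh
  where
  M = maximum (x ∷ xs)
  partner = partnerʳ (x ∷ xs) ys e (maximum-∈ x xs)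
  v = proj₁ partner
  ≤v : ∀ {t} → t ∈ ys → t ≤ v
  ≤v t∈ = let u , u↦t = partnerˡ (x ∷ xs) ys e t∈ in
    ≮⇒≥ (λ v<t → <⇒≱ (Equivalence.from (coh (proj₂ partner) u↦t) v<t)
                     (All.lookup (≤-maximum (x ∷ xs)) (∈-zip⇒∈ˡ (x ∷ xs) ys u↦t)))
  v≡max : v ≡ maximum ys
  v≡max = sym (maximum-unique ys (∈-zip⇒∈ʳ (x ∷ xs) ys (proj₂ partner)) (All.tabulate ≤v))
  max↦max : (M , maximum ys) ∈ zip (x ∷ xs) ys
  max↦max = subst (λ w → (M , w) ∈ zip (x ∷ xs) ys) v≡max (proj₂ partner)
  lengths : length (dropMax (x ∷ xs)) ≡ length (dropMax ys)
  lengths = suc-injective (trans (length-delete M (x ∷ xs) (maximum-∈ x xs))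
              (trans e (sym (length-delete (maximum ys) ys (∈-zip⇒∈ʳ (x ∷ xs) ys max↦max)))))

dropMax-mono : ∀ {xs ys} → xs ⊆ ys → dropMax xs ⊆ dropMax ys
dropMax-mono {xs} {ys} s with maximum ys ∈? xs
... | yes m∈ = subst (λ m → delete m xs ⊆ dropMax ys) (sym max≡) (delete-mono (maximum ys) s)
  where max≡ = ≤-antisym (maximum-mono-⊆ s) (All.lookup (≤-maximum xs) m∈)
... | no m∉ = ⊆-trans (delete-⊆ (maximum xs) xs)
                (subst (_⊆ dropMax ys) (delete-∉ (maximum ys) xs m∉) (delete-mono (maximum ys) s))

dropMax-lift : ∀ x xs {zs} → zs ⊆ dropMax (x ∷ xs) →
  Σ (List ℕ) λ ys → ys ⊆ x ∷ xs × dropMax ys ≡ zs × length ys ≡ suc (length zs)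
dropMax-lift x xs s =
  let ys , ys⊆ , m∈ys , del , len = delete-lift (maximum (x ∷ xs)) (x ∷ xs) (maximum-∈ x xs) s
      max≡ = ≤-antisym (maximum-mono-⊆ ys⊆) (All.lookup (≤-maximum ys) m∈ys)
  in ys , ys⊆ , trans (cong (λ m → delete m ys) max≡) del , len

largestEntry : EntryDeletion
largestEntry = record
  { del        = dropMax
  ; del-⊆      = λ xs → delete-⊆ (maximum xs) xs
  ; del-mono   = dropMax-mono
  ; del-≅      = dropMax-≅
  ; length-del = λ x xs → length-delete (maximum (x ∷ xs)) (x ∷ xs) (maximum-∈ x xs)
  ; del-lift   = dropMax-lift
  }

-- Reassembly from the three deletions

length-snoc : ∀ (xs : List ℕ) z → length (xs ++ z ∷ []) ≡ suc (length xs)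
length-snoc xs _ = trans (length-++ xs) (+-comm (length xs) 1)

private
  head-above : ∀ {x y t t′} → x ∷ t ≅ y ∷ t′ → All (_< x) t → All (_< y) t′
  head-above {t = t} {t′} (e , coh) t<x = All.tabulate λ b∈ →
    let _ , a↦b = partnerˡ t t′ (suc-injective e) b∈
    in Equivalence.to (coh (there a↦b) (here refl)) (All.lookup t<x (∈-zip⇒∈ˡ t t′ a↦b))

  last-above : ∀ {z z′ as bs} → as ++ z ∷ [] ≅ bs ++ z′ ∷ [] → All (_< z) as → All (_< z′) bs
  last-above {z} {z′} {as} {bs} (e , coh) as<z = All.tabulate λ b∈ →
    let _ , a↦b = partnerˡ as bs lengths b∈
    in Equivalence.to (coh′ (∈-++⁺ˡ a↦b) (∈-++⁺ʳ (zip as bs) (here refl))) (All.lookup as<z (∈-zip⇒∈ˡ as bs a↦b))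
    where
    lengths : length as ≡ length bs
    lengths = suc-injective (trans (sym (length-snoc as z)) (trans e (length-snoc bs z′)))
    coh′ : Coherent (zip as bs ++ (z , z′) ∷ [])
    coh′ = subst Coherent (zip-++ as (z ∷ []) bs (z′ ∷ []) lengths) coh

  -- The partner of z would have to lie above b, since a < z.
  last-top≇head-top : ∀ {a as z b bs} → All (_< z) (a ∷ as) → All (_< b) bs → ¬ (a ∷ as ++ z ∷ [] ≅ b ∷ bs)
  last-top≇head-top {a} {as} {z} {b} {bs} (a<z ∷ _) bs<b (e , coh)
    with partnerʳ (a ∷ as ++ z ∷ []) (b ∷ bs) e (there (∈-++⁺ʳ as (here refl)))
  ... | _ , here refl = <-irrefl refl a<z
  ... | _ , there z↦w =
    <-asym (Equivalence.to (coh (here refl) (there z↦w)) a<z) (All.lookup bs<b (∈-zip⇒∈ʳ (as ++ z ∷ []) bs z↦w))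

  below-head : ∀ {x} rest → x ∉ rest → maximum (x ∷ rest) ≡ x → All (_< x) rest
  below-head {x} rest x∉ max≡x = All.tabulate λ u∈ →
    ≤∧≢⇒< (subst (_ ≤_) max≡x (All.lookup (≤-maximum (x ∷ rest)) (there u∈))) λ { refl → x∉ u∈ }

  below-last : ∀ {z} init → z ∉ init → maximum (init ++ z ∷ []) ≡ z → All (_< z) init
  below-last {z} init z∉ max≡z = All.tabulate λ u∈ →
    ≤∧≢⇒< (subst (_ ≤_) max≡z (All.lookup (≤-maximum (init ++ z ∷ [])) (∈-++⁺ˡ u∈))) λ { refl → z∉ u∈ }

  ∈-ends : ∀ {v x z : ℕ} mid → v ∈ x ∷ mid ++ z ∷ [] → v ≡ x ⊎ v ∈ mid ⊎ v ≡ z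
  ∈-ends mid (here v≡x) = inj₁ v≡x
  ∈-ends mid (there v∈) with ∈-++⁻ mid v∈
  ... | inj₁ v∈mid = inj₂ (inj₁ v∈mid)
  ... | inj₂ (here v≡z) = inj₂ (inj₂ v≡z)

module TopTransfer (x y z z′ m m′ : ℕ) (ms ms′ : List ℕ)
  (dxs : Distinct (x ∷ (m ∷ ms) ++ z ∷ [])) (dys : Distinct (y ∷ (m′ ∷ ms′) ++ z′ ∷ []))
  (first : (m ∷ ms) ++ z ∷ [] ≅ (m′ ∷ ms′) ++ z′ ∷ [])
  (last : x ∷ m ∷ ms ≅ y ∷ m′ ∷ ms′)
  (largest : dropMax (x ∷ (m ∷ ms) ++ z ∷ []) ≅ dropMax (y ∷ (m′ ∷ ms′) ++ z′ ∷ []))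
  where

  private
    mid mid′ xs ys : List ℕ
    mid = m ∷ ms
    mid′ = m′ ∷ ms′
    xs = x ∷ mid ++ z ∷ []
    ys = y ∷ mid′ ++ z′ ∷ []

    z′∉mid′ : z′ ∉ mid′
    z′∉mid′ = Distinct-∉-last mid′ z′ (proj₂ dys)

    y≢z′ : y ≢ z′
    y≢z′ refl = proj₁ dys (∈-++⁺ʳ mid′ (here refl))

  head-top : All (_< x) (mid ++ z ∷ []) → All (_< y) (mid′ ++ z′ ∷ [])
  head-top mid<x with <-cmp y z′
  ... | tri> _ _ z′<y = All.++⁺ mid′<y (z′<y ∷ [])
    where mid′<y = head-above last (All.++⁻ˡ mid mid<x)
  ... | tri≈ _ y≡z′ _ = ⊥-elim (y≢z′ y≡z′)
  ... | tri< y<z′ _ _ = ⊥-elim (last-top≇head-top mid<z mid′<y (subst₂ _≅_ dropX dropY largest))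
    where
    mid′<y = head-above last (All.++⁻ˡ mid mid<x)
    mid′<z′ = All.map (λ u<y → <-trans u<y y<z′) mid′<y
    mid<z = last-above (≅-sym first) mid′<z′
    dropX : dropMax xs ≡ mid ++ z ∷ []
    dropX = trans (cong (λ M → delete M xs) (maximum-unique xs (here refl) (≤-refl ∷ All.map <⇒≤ mid<x)))
                  (delete-head x _)
    dropY : dropMax ys ≡ y ∷ mid′
    dropY = trans (cong (λ M → delete M ys)
                    (maximum-unique ys (there (∈-++⁺ʳ mid′ (here refl)))
                      (<⇒≤ y<z′ ∷ All.++⁺ (All.map <⇒≤ mid′<z′) (≤-refl ∷ []))))
                  (trans (delete-cons z′ y _ y≢z′) (cong (y ∷_) (delete-last z′ mid′ z′∉mid′)))

  last-top : All (_< z) (x ∷ mid) → All (_< z′) (y ∷ mid′)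
  last-top (x<z ∷ mid<z) with <-cmp y z′
  ... | tri< y<z′ _ _ = y<z′ ∷ last-above first mid<z
  ... | tri≈ _ y≡z′ _ = ⊥-elim (y≢z′ y≡z′)
  ... | tri> _ _ z′<y = ⊥-elim (last-top≇head-top mid′<z′ mid<x (≅-sym (subst₂ _≅_ dropX dropY largest)))
    where
    mid′<z′ = last-above first mid<z
    mid′<y = All.map (λ u<z′ → <-trans u<z′ z′<y) mid′<z′
    mid<x = head-above (≅-sym last) mid′<y
    dropX : dropMax xs ≡ x ∷ mid
    dropX = trans (cong (λ M → delete M xs)
                    (maximum-unique xs (there (∈-++⁺ʳ mid (here refl)))
                      (<⇒≤ x<z ∷ All.++⁺ (All.map <⇒≤ mid<z) (≤-refl ∷ []))))
                  (trans (delete-cons z x _ (<⇒≢ x<z)) (cong (x ∷_) (delete-last z mid (Distinct-∉-last mid z (proj₂ dxs)))))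
    dropY : dropMax ys ≡ mid′ ++ z′ ∷ []
    dropY = trans (cong (λ M → delete M ys)
                    (maximum-unique ys (here refl) (≤-refl ∷ All.++⁺ (All.map <⇒≤ mid′<y) (<⇒≤ z′<y ∷ []))))
                  (delete-head y _)

private
  ≅-ends : ∀ {x y z z′ as bs} → x ∷ as ++ z ∷ [] ≅ y ∷ bs ++ z′ ∷ [] →
    SameOrder (x , y) (z , z′) × SameOrder (z , z′) (x , y)
  ≅-ends {x} {y} {z} {z′} {as} {bs} (e , coh) = coh (here refl) (there z↦z′) , coh (there z↦z′) (here refl)
    where
    lengths : length as ≡ length bs
    lengths = suc-injective (trans (sym (length-snoc as z)) (trans (suc-injective e) (length-snoc bs z′)))
    z↦z′ : (z , z′) ∈ zip (as ++ z ∷ []) (bs ++ z′ ∷ [])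
    z↦z′ = subst ((z , z′) ∈_) (sym (zip-++ as (z ∷ []) bs (z′ ∷ []) lengths)) (∈-++⁺ʳ (zip as bs) (here refl))

module _ (x y z z′ m m′ : ℕ) (ms ms′ : List ℕ)
  (dxs : Distinct (x ∷ (m ∷ ms) ++ z ∷ [])) (dys : Distinct (y ∷ (m′ ∷ ms′) ++ z′ ∷ []))
  (first : (m ∷ ms) ++ z ∷ [] ≅ (m′ ∷ ms′) ++ z′ ∷ [])
  (last : x ∷ m ∷ ms ≅ y ∷ m′ ∷ ms′)
  (largest : dropMax (x ∷ (m ∷ ms) ++ z ∷ []) ≅ dropMax (y ∷ (m′ ∷ ms′) ++ z′ ∷ []))
  where

  private
    module XY = TopTransfer x y z z′ m m′ ms ms′ dxs dys first last largest
    module YX = TopTransfer y x z′ z m′ m ms′ ms dys dxs (≅-sym first) (≅-sym last) (≅-sym largest)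
    mid mid′ xs ys : List ℕ
    mid = m ∷ ms
    mid′ = m′ ∷ ms′
    xs = x ∷ mid ++ z ∷ []
    ys = y ∷ mid′ ++ z′ ∷ []

    dropMax-inner : ∀ {w ws v} → Distinct (w ∷ ws ++ v ∷ []) → maximum (w ∷ ws ++ v ∷ []) ∈ ws →
      dropMax (w ∷ ws ++ v ∷ []) ≡ w ∷ delete (maximum (w ∷ ws ++ v ∷ [])) ws ++ v ∷ []
    dropMax-inner {w} {ws} {v} (w∉ , _) M∈ =
      trans (delete-cons _ w _ (λ w≡M → w∉ (∈-++⁺ˡ (subst (_∈ ws) (sym w≡M) M∈))))
            (cong (w ∷_) (delete-++ˡ _ ws (v ∷ []) M∈))

  ends-agree : SameOrder (x , y) (z , z′) × SameOrder (z , z′) (x , y)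
  ends-agree with ∈-ends mid (maximum-∈ x (mid ++ z ∷ []))
  ... | inj₁ M≡x =
    mk⇔ (λ x<z → ⊥-elim (<-asym x<z z<x)) (λ y<z′ → ⊥-elim (<-asym y<z′ z′<y)) , mk⇔ (λ _ → z′<y) (λ _ → z<x)
    where
    head-top = below-head _ (proj₁ dxs) M≡x
    z<x = All.lookup head-top (∈-++⁺ʳ mid (here refl))
    z′<y = All.lookup (XY.head-top head-top) (∈-++⁺ʳ mid′ (here refl))
  ... | inj₂ (inj₂ M≡z) =
    mk⇔ (λ _ → y<z′) (λ _ → x<z) , mk⇔ (λ z<x → ⊥-elim (<-asym z<x x<z)) (λ z′<y → ⊥-elim (<-asym z′<y y<z′))
    where
    last-top = below-last (x ∷ mid) (Distinct-∉-last (x ∷ mid) z dxs) M≡z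
    x<z = All.lookup last-top (here refl)
    y<z′ = All.lookup (XY.last-top last-top) (here refl)
  ... | inj₂ (inj₁ M∈mid) with ∈-ends mid′ (maximum-∈ y (mid′ ++ z′ ∷ []))
  ...   | inj₁ M′≡y =
    ⊥-elim (<⇒≱ (All.lookup (YX.head-top (below-head _ (proj₁ dys) M′≡y)) (∈-++⁺ˡ M∈mid))
                (All.lookup (≤-maximum xs) (here refl)))
  ...   | inj₂ (inj₂ M′≡z′) =
    ⊥-elim (<⇒≱ (All.lookup (YX.last-top (below-last (y ∷ mid′) (Distinct-∉-last (y ∷ mid′) z′ dys) M′≡z′))
                            (there M∈mid))
                (All.lookup (≤-maximum xs) (there (∈-++⁺ʳ mid (here refl)))))
  ...   | inj₂ (inj₁ M′∈mid′) = ≅-ends (subst₂ _≅_ (dropMax-inner dxs M∈mid) (dropMax-inner dys M′∈mid′) largest)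

  reassemble-snoc : xs ≅ ys
  reassemble-snoc = cong suc (proj₁ first) , coh
    where
    lengths : length mid ≡ length mid′
    lengths = suc-injective (proj₁ last)
    split : ∀ {p} → p ∈ zip (mid ++ z ∷ []) (mid′ ++ z′ ∷ []) → p ∈ zip mid mid′ ⊎ p ≡ (z , z′)
    split {p} p∈ with ∈-++⁻ (zip mid mid′) (subst (p ∈_) (zip-++ mid (z ∷ []) mid′ (z′ ∷ []) lengths) p∈)
    ... | inj₁ p∈mid = inj₁ p∈mid
    ... | inj₂ (here p≡) = inj₂ p≡
    coh : Coherent (zip xs ys)
    coh (there p) (there q) = proj₂ first p q
    coh (here refl) (here refl) = SameOrder-refl _
    coh (here refl) (there q) with split q
    ... | inj₁ q∈ = proj₂ last (here refl) (there q∈)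
    ... | inj₂ refl = proj₁ ends-agree
    coh (there p) (here refl) with split p
    ... | inj₁ p∈ = proj₂ last (there p∈) (here refl)
    ... | inj₂ refl = proj₂ ends-agree

reassemble : ∀ {xs ys} → Distinct xs → Distinct ys → length xs ≡ length ys → 3 ≤ length xs →
  drop 1 xs ≅ drop 1 ys → dropLast xs ≅ dropLast ys → dropMax xs ≅ dropMax ys → xs ≅ ys
reassemble {x ∷ rest} {y ∷ rest′} dxs dys e 3≤ first last largest with initLast rest | initLast rest′
... | (m ∷ ms) ∷ʳ′ z | (m′ ∷ ms′) ∷ʳ′ z′ =
  reassemble-snoc x y z z′ m m′ ms ms′ dxs dys first
    (subst₂ _≅_ (dropLast-snoc (x ∷ m ∷ ms) z) (dropLast-snoc (y ∷ m′ ∷ ms′) z′) last) largest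
... | [] | _ = ⊥-elim (<⇒≱ (s≤s (s≤s z≤n)) 3≤)
... | [] ∷ʳ′ _ | _ = ⊥-elim (<⇒≱ (s≤s (s≤s (s≤s z≤n))) 3≤)
... | _ | [] = ⊥-elim (<⇒≱ (s≤s (s≤s z≤n)) (subst (3 ≤_) e 3≤))
... | _ | [] ∷ʳ′ _ = ⊥-elim (<⇒≱ (s≤s (s≤s (s≤s z≤n))) (subst (3 ≤_) e 3≤))

-- Standardization and rigidity of permutations

range : ℕ → List ℕ
range n = map suc (upTo n)

length-range : ∀ n → length (range n) ≡ n
length-range n = trans (length-map suc (upTo n)) (length-upTo n)

Unique⇒Distinct : ∀ {xs : List ℕ} → Unique xs → Distinct xs
Unique⇒Distinct [] = tt
Unique⇒Distinct (x≢xs ∷ u) = All¬⇒¬Any x≢xs , Unique⇒Distinct u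

Distinct-↭ : ∀ {xs ys : List ℕ} → xs ↭ ys → Distinct xs → Distinct ys
Distinct-↭ ↭.refl d = d
Distinct-↭ (prep x p) (x∉ , d) = x∉ ∘ ∈-resp-↭ (↭-sym p) , Distinct-↭ p d
Distinct-↭ (swap x y p) (x∉ , y∉ , d) =
  (λ { (here refl) → x∉ (here refl) ; (there y∈) → y∉ (∈-resp-↭ (↭-sym p) y∈) }) ,
  x∉ ∘ there ∘ ∈-resp-↭ (↭-sym p) , Distinct-↭ p d
Distinct-↭ (↭.trans p q) d = Distinct-↭ q (Distinct-↭ p d)

Distinct-entries : ∀ π → Distinct (entries π)
Distinct-entries π = Distinct-↭ (↭-sym (isPerm π)) (Unique⇒Distinct (Unique.map⁺ suc-injective (Unique.upTo⁺ _)))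

∈-range⁻ : ∀ {u n} → u ∈ range n → u ≤ n
∈-range⁻ u∈ with ∈-map⁻ suc u∈
... | _ , i∈ , refl = ∈-upTo⁻ i∈

isBelow : ℕ → ℕ → ℕ
isBelow a x with a <? x
... | yes _ = 1
... | no _ = 0

isBelow-⇔ : ∀ {a x b y} → (a < x) ⇔ (b < y) → isBelow a x ≡ isBelow b y
isBelow-⇔ {a} {x} {b} {y} a⇔b with a <? x | b <? y
... | yes _ | yes _ = refl
... | no _ | no _ = refl
... | yes a<x | no b≮y = ⊥-elim (b≮y (Equivalence.to a⇔b a<x))
... | no a≮x | yes b<y = ⊥-elim (a≮x (Equivalence.from a⇔b b<y))

below : ℕ → List ℕ → ℕ
below x l = sum (map (λ a → isBelow a x) l)

below-↭ : ∀ x {l l′} → l ↭ l′ → below x l ≡ below x l′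
below-↭ x p = sum-↭ (↭-map⁺ _ p)

below-self : ∀ x l → below x (x ∷ l) ≡ below x l
below-self x l with x <? x
... | yes x<x = ⊥-elim (<-irrefl refl x<x)
... | no _ = refl

below-Pointwise : ∀ {x y xs ys} → Pointwise (λ a b → (a < x) ⇔ (b < y)) xs ys → below x xs ≡ below y ys
below-Pointwise [] = refl
below-Pointwise {x} {y} (_∷_ {x = a} {y = b} a⇔b rest) =
  cong₂ _+_ (isBelow-⇔ a⇔b) (below-Pointwise rest)

isBelow-mono : ∀ a {x y} → x ≤ y → isBelow a x ≤ isBelow a y
isBelow-mono a {x} {y} x≤y with a <? x | a <? y
... | yes _ | yes _ = ≤-refl
... | no _ | _ = z≤n
... | yes a<x | no a≮y = ⊥-elim (a≮y (<-≤-trans a<x x≤y))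

below-mono : ∀ {x y} l → x ≤ y → below x l ≤ below y l
below-mono [] _ = z≤n
below-mono (a ∷ l) x≤y = +-mono-≤ (isBelow-mono a x≤y) (below-mono l x≤y)

below-< : ∀ {x y l} → x < y → x ∈ l → below x l < below y l
below-< {x} {y} {_ ∷ l} x<y (here refl) rewrite below-self x l with x <? y
... | yes _ = s≤s (below-mono l (<⇒≤ x<y))
... | no x≮y = ⊥-elim (x≮y x<y)
below-< {l = a ∷ _} x<y (there x∈) = +-mono-≤-< (isBelow-mono a (<⇒≤ x<y)) (below-< x<y x∈)

private
  same-rank : ∀ {x y xs ys S} → x ∷ xs ↭ S → y ∷ ys ↭ S →
    Pointwise (λ a b → (a < x) ⇔ (b < y)) xs ys → below x S ≡ below y S
  same-rank {x} {y} {xs} {ys} {S} x∷xs↭S y∷ys↭S agree = begin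
    below x S         ≡⟨ below-↭ x x∷xs↭S ⟨
    below x (x ∷ xs)  ≡⟨ below-self x xs ⟩
    below x xs        ≡⟨ below-Pointwise agree ⟩
    below y ys        ≡⟨ below-self y ys ⟨
    below y (y ∷ ys)  ≡⟨ below-↭ y y∷ys↭S ⟩
    below y S         ∎
    where open ≡-Reasoning

-- Each entry is determined by the number of entries of S below it.
↭-OrdIso⇒≡ : ∀ {xs ys S} → xs ↭ S → ys ↭ S → OrdIso xs ys → xs ≡ ys
↭-OrdIso⇒≡ {[]} {[]} _ _ _ = refl
↭-OrdIso⇒≡ {x ∷ xs} {y ∷ ys} x∷xs↭S y∷ys↭S (agree , iso) with <-cmp x y
... | tri< x<y _ _ = ⊥-elim (<-irrefl (same-rank x∷xs↭S y∷ys↭S (Pointwise.map proj₂ agree))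
                                      (below-< x<y (∈-resp-↭ x∷xs↭S (here refl))))
... | tri> _ _ y<x = ⊥-elim (<-irrefl (same-rank y∷ys↭S x∷xs↭S (Pointwise.symmetric (⇔-sym ∘ proj₂) agree))
                                      (below-< y<x (∈-resp-↭ y∷ys↭S (here refl))))
... | tri≈ _ refl _ = cong (x ∷_) (↭-OrdIso⇒≡ ↭-refl (drop-∷ (↭-trans y∷ys↭S (↭-sym x∷xs↭S))) iso)

≅⇒≡ : ∀ (π σ : Perm) → entries π ≅ entries σ → entries π ≡ entries σ
≅⇒≡ π σ π≅σ = ↭-OrdIso⇒≡ (isPerm π) (subst (λ n → entries σ ↭ range n) (sym (proj₁ π≅σ)) (isPerm σ))
                          (≅⇒OrdIso _ _ π≅σ)

∈-++-insert : ∀ {v M} as {bs : List ℕ} → v ∈ as ++ bs → v ∈ as ++ M ∷ bs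
∈-++-insert as v∈ with ∈-++⁻ as v∈
... | inj₁ v∈as = ∈-++⁺ˡ v∈as
... | inj₂ v∈bs = ∈-++⁺ʳ as (there v∈bs)

Distinct-middle : ∀ as {M bs} → Distinct (as ++ M ∷ bs) → M ∉ as ++ bs × Distinct (as ++ bs)
Distinct-middle [] (M∉ , d) = M∉ , d
Distinct-middle (a ∷ as) (a∉ , d) =
  let M∉ , d′ = Distinct-middle as d
  in (λ { (here refl) → a∉ (∈-++⁺ʳ as (here refl)) ; (there M∈) → M∉ M∈ }) ,
     (λ a∈ → a∉ (∈-++-insert as a∈)) , d′

insert-above-≅ : ∀ {cs ds as bs N M} → length cs ≡ length as → cs ++ ds ≅ as ++ bs →
  All (_< N) (cs ++ ds) → All (_< M) (as ++ bs) → cs ++ N ∷ ds ≅ as ++ M ∷ bs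
insert-above-≅ {cs} {ds} {as} {bs} {N} {M} e (lengths , coh) cds<N abs<M =
  trans (length-++-sucʳ cs N ds) (trans (cong suc lengths) (sym (length-++-sucʳ as M bs))) ,
  subst Coherent (sym new-pairs) (λ p q → compare (classify p) (classify q))
  where
  old-pairs : zip (cs ++ ds) (as ++ bs) ≡ zip cs as ++ zip ds bs
  old-pairs = zip-++ cs ds as bs e
  new-pairs : zip (cs ++ N ∷ ds) (as ++ M ∷ bs) ≡ zip cs as ++ (N , M) ∷ zip ds bs
  new-pairs = zip-++ cs (N ∷ ds) as (M ∷ bs) e
  classify : ∀ {p} → p ∈ zip cs as ++ (N , M) ∷ zip ds bs → p ∈ zip (cs ++ ds) (as ++ bs) ⊎ p ≡ (N , M)
  classify p∈ with ∈-++⁻ (zip cs as) p∈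
  ... | inj₁ p∈ᶜ = inj₁ (subst (_ ∈_) (sym old-pairs) (∈-++⁺ˡ p∈ᶜ))
  ... | inj₂ (here p≡) = inj₂ p≡
  ... | inj₂ (there p∈ᵈ) = inj₁ (subst (_ ∈_) (sym old-pairs) (∈-++⁺ʳ (zip cs as) p∈ᵈ))
  below-top : ∀ {u v} → (u , v) ∈ zip (cs ++ ds) (as ++ bs) → u < N × v < M
  below-top p∈ = All.lookup cds<N (∈-zip⇒∈ˡ (cs ++ ds) (as ++ bs) p∈) , All.lookup abs<M (∈-zip⇒∈ʳ (cs ++ ds) (as ++ bs) p∈)
  compare : ∀ {p q} → p ∈ zip (cs ++ ds) (as ++ bs) ⊎ p ≡ (N , M) → q ∈ zip (cs ++ ds) (as ++ bs) ⊎ q ≡ (N , M) →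
    SameOrder p q
  compare (inj₁ p∈) (inj₁ q∈) = coh p∈ q∈
  compare (inj₁ p∈) (inj₂ refl) = mk⇔ (λ _ → proj₂ (below-top p∈)) (λ _ → proj₁ (below-top p∈))
  compare (inj₂ refl) (inj₁ q∈) =
    mk⇔ (λ N<u → ⊥-elim (<-asym N<u (proj₁ (below-top q∈)))) (λ M<v → ⊥-elim (<-asym M<v (proj₂ (below-top q∈))))
  compare (inj₂ refl) (inj₂ refl) = SameOrder-refl _

range-∷ʳ : ∀ n → range n ++ suc n ∷ [] ≡ range (suc n)
range-∷ʳ n = trans (sym (map-++ suc (upTo n) (n ∷ []))) (cong (map suc) (upTo-∷ʳ n))

private
  -- Insert n + 1, at the position of the maximum, into the standardization of the other entries.
  standardize′ : ∀ n zs → length zs ≡ n → Distinct zs → Σ Perm λ ρ → entries ρ ≅ zs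
  standardize′ zero [] _ _ = mkPerm [] ↭-refl , refl , λ ()
  standardize′ (suc n) (z ∷ zs) len d with ∈-∃++ (maximum-∈ z zs)
  ... | as , bs , z∷zs≡ = mkPerm new new↭ , subst (new ≅_) (sym z∷zs≡) new≅
    where
    M = maximum (z ∷ zs)
    d′ = subst Distinct z∷zs≡ d
    M∉ = proj₁ (Distinct-middle as d′)
    len′ : length (as ++ bs) ≡ n
    len′ = suc-injective (trans (sym (length-++-sucʳ as M bs)) (trans (cong length (sym z∷zs≡)) len))
    rest = standardize′ n (as ++ bs) len′ (proj₂ (Distinct-middle as d′))
    ρ = proj₁ rest
    ρ≅ = proj₂ rest
    k = length as
    cs = take k (entries ρ)
    ds = drop k (entries ρ)
    N = suc n
    new = cs ++ N ∷ ds
    ρ-len : length (entries ρ) ≡ n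
    ρ-len = trans (proj₁ ρ≅) len′
    ρ↭ : cs ++ ds ↭ range n
    ρ↭ = subst₂ (λ l m → l ↭ range m) (sym (take++drop≡id k (entries ρ))) ρ-len (isPerm ρ)
    cs-len : length cs ≡ k
    cs-len = trans (length-take k (entries ρ)) (m≤n⇒m⊓n≡m (subst (k ≤_) (sym (proj₁ ρ≅)) (length-++-≤ˡ as)))
    new-len : length new ≡ N
    new-len = trans (length-++-sucʳ cs N ds) (cong suc (trans (cong length (take++drop≡id k (entries ρ))) ρ-len))
    new↭ : new ↭ range (length new)
    new↭ = subst (λ m → new ↭ range m) (sym new-len)
      (begin
        cs ++ N ∷ ds     ↭⟨ shift N cs ds ⟩
        N ∷ cs ++ ds     ↭⟨ prep N ρ↭ ⟩
        N ∷ range n      ↭⟨ ∷↭∷ʳ N (range n) ⟩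
        range n ++ N ∷ [] ≡⟨ range-∷ʳ n ⟩
        range N          ∎)
      where open PermutationReasoning
    new≅ : new ≅ as ++ M ∷ bs
    new≅ = insert-above-≅ cs-len (subst (_≅ as ++ bs) (sym (take++drop≡id k (entries ρ))) ρ≅)
             (All.tabulate λ u∈ → s≤s (∈-range⁻ (∈-resp-↭ ρ↭ u∈)))
             (All.tabulate λ u∈ →
               ≤∧≢⇒< (All.lookup (≤-maximum (z ∷ zs)) (subst (_ ∈_) (sym z∷zs≡) (∈-++-insert as u∈)))
                     (λ u≡M → M∉ (subst (_∈ as ++ bs) u≡M u∈)))

standardize : ∀ zs → Distinct zs → Σ Perm λ ρ → entries ρ ≅ zs
standardize zs = standardize′ (length zs) zs refl

-- Patterns and decks

size : Perm → ℕ
size π = length (entries π)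

≼-refl : ∀ π → π ≼ π
≼-refl π = entries π , ⊆-refl , ≅⇒OrdIso _ _ (≅-refl _)

≼-respˡ : ∀ {σ σ′ π} → entries σ ≡ entries σ′ → σ ≼ π → σ′ ≼ π
≼-respˡ σ≡σ′ (ys , ys⊆ , iso) = ys , ys⊆ , subst (λ e → OrdIso e ys) σ≡σ′ iso

≼-respʳ : ∀ {σ π π′} → entries π ≡ entries π′ → σ ≼ π → σ ≼ π′
≼-respʳ π≡π′ (ys , ys⊆ , iso) = ys , subst (ys ⊆_) π≡π′ ys⊆ , iso

≡⇒≼ : ∀ σ π → entries σ ≡ entries π → σ ≼ π
≡⇒≼ σ π σ≡π = ≼-respʳ {σ} {σ} {π} σ≡π (≼-refl σ)

size-≼ : ∀ {σ π} → σ ≼ π → size σ ≤ size π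
size-≼ {σ} {π} (ys , ys⊆ , iso) = subst (_≤ size π) (sym (proj₁ (OrdIso⇒≅ (entries σ) ys iso))) (length-mono-≤ ys⊆)

≼-same-size : ∀ {σ π} → σ ≼ π → size σ ≡ size π → entries σ ≡ entries π
≼-same-size {σ} {π} (ys , ys⊆ , iso) same = ≅⇒≡ σ π (subst (entries σ ≅_) ys≡ σ≅ys)
  where
  σ≅ys = OrdIso⇒≅ (entries σ) ys iso
  ys≡ : ys ≡ entries π
  ys≡ = ≋⇒≡ (to-≋ {as = ys} {bs = entries π} (trans (sym (proj₁ σ≅ys)) same) ys⊆)

≼-antisym : ∀ {σ π} → σ ≼ π → π ≼ σ → entries σ ≡ entries π
≼-antisym {σ} {π} σ≼π π≼σ =
  ≼-same-size {σ} {π} σ≼π (≤-antisym (size-≼ {σ} {π} σ≼π) (size-≼ {π} {σ} π≼σ))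

pattern-of-size : ∀ π k → size π ≡ suc k → Σ Perm λ ρ → ρ ≼ π × size ρ ≡ k
pattern-of-size (mkPerm (x ∷ xs) p) k size≡ =
  let ρ , ρ≅xs = standardize xs (proj₂ (Distinct-entries (mkPerm (x ∷ xs) p)))
  in ρ , (xs , x ∷ʳ ⊆-refl , ≅⇒OrdIso _ _ ρ≅xs) , trans (proj₁ ρ≅xs) (suc-injective size≡)

SameDeck : ℕ → Perm → Perm → Set
SameDeck n π σ = ∀ ρ → suc (size ρ) ≡ n → (ρ ≼ π) ⇔ (ρ ≼ σ)

PatternsIncluded : ℕ → List ℕ → List ℕ → Set
PatternsIncluded k xs ys = ∀ zs → zs ⊆ xs → length zs ≡ k → Occurs zs ys

≼⇒PatternsIncluded : ∀ {π σ} k → (∀ ρ → size ρ ≡ k → ρ ≼ π → ρ ≼ σ) →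
  PatternsIncluded k (entries π) (entries σ)
≼⇒PatternsIncluded {π} k incl zs zs⊆ len =
  let ρ , ρ≅zs = standardize zs (Distinct-⊆ zs⊆ (Distinct-entries π))
      ws , ws⊆ , iso = incl ρ (trans (proj₁ ρ≅zs) len) (zs , zs⊆ , ≅⇒OrdIso _ _ ρ≅zs)
  in ws , ws⊆ , ≅-trans (≅-sym ρ≅zs) (OrdIso⇒≅ _ _ iso)

PatternsIncluded⇒≼ : ∀ {σ₁ σ₂ xs ys} k → entries σ₁ ≅ xs → entries σ₂ ≅ ys → PatternsIncluded k xs ys →
  ∀ ρ → size ρ ≡ k → ρ ≼ σ₁ → ρ ≼ σ₂
PatternsIncluded⇒≼ k σ₁≅xs σ₂≅ys incl ρ len (ws , ws⊆ , iso) =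
  let us , us⊆ , ρ≅us = Occurs-resp-≅ (ws , ws⊆ , OrdIso⇒≅ _ _ iso) σ₁≅xs
      vs , vs⊆ , us≅vs = incl us us⊆ (trans (sym (proj₁ ρ≅us)) len)
      ts , ts⊆ , ρ≅ts = Occurs-resp-≅ (vs , vs⊆ , ≅-trans ρ≅us us≅vs) (≅-sym σ₂≅ys)
  in ts , ts⊆ , ≅⇒OrdIso _ _ ρ≅ts

module _ (D : EntryDeletion) where
  open EntryDeletion D

  PatternsIncluded-del : ∀ {k x xs ys} → Distinct (x ∷ xs) → Distinct ys →
    PatternsIncluded (suc k) (x ∷ xs) ys → PatternsIncluded k (del (x ∷ xs)) (del ys)
  PatternsIncluded-del {x = x} {xs} dxs dys incl zs zs⊆ len =
    let cs , cs⊆ , del-cs , len-cs = del-lift x xs zs⊆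
        ws , ws⊆ , cs≅ws = incl cs cs⊆ (trans len-cs (cong suc len))
    in del ws , del-mono ws⊆ , subst (_≅ del ws) del-cs (del-≅ (Distinct-⊆ cs⊆ dxs) (Distinct-⊆ ws⊆ dys) cs≅ws)

  del-≅-by-induction : ∀ j →
    (∀ σ₁ σ₂ → size σ₁ ≡ suc j → size σ₂ ≡ suc j → SameDeck (suc j) σ₁ σ₂ → entries σ₁ ≡ entries σ₂) →
    ∀ {x xs y ys} → length (x ∷ xs) ≡ suc (suc j) → length (y ∷ ys) ≡ suc (suc j) →
    Distinct (x ∷ xs) → Distinct (y ∷ ys) →
    PatternsIncluded (suc j) (x ∷ xs) (y ∷ ys) → PatternsIncluded (suc j) (y ∷ ys) (x ∷ xs) →
    del (x ∷ xs) ≅ del (y ∷ ys)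
  del-≅-by-induction j IH {x} {xs} {y} {ys} lx ly dxs dys incl incl′ =
    ≅-trans (≅-sym σ₁≅) (subst (_≅ del (y ∷ ys)) (sym σ₁≡σ₂) σ₂≅)
    where
    std₁ = standardize (del (x ∷ xs)) (Distinct-⊆ (del-⊆ _) dxs)
    std₂ = standardize (del (y ∷ ys)) (Distinct-⊆ (del-⊆ _) dys)
    σ₁ = proj₁ std₁
    σ₂ = proj₁ std₂
    σ₁≅ = proj₂ std₁
    σ₂≅ = proj₂ std₂
    σ₁≡σ₂ : entries σ₁ ≡ entries σ₂
    σ₁≡σ₂ = IH σ₁ σ₂ (trans (proj₁ σ₁≅) (suc-injective (trans (length-del x xs) lx)))
                     (trans (proj₁ σ₂≅) (suc-injective (trans (length-del y ys) ly)))
                     λ ρ len →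
                       mk⇔ (PatternsIncluded⇒≼ {σ₁} {σ₂} j σ₁≅ σ₂≅ (PatternsIncluded-del dxs dys incl) ρ (suc-injective len))
                           (PatternsIncluded⇒≼ {σ₂} {σ₁} j σ₂≅ σ₁≅ (PatternsIncluded-del dys dxs incl′) ρ (suc-injective len))

-- Enumerating permutations and deciding containment

select : List ℕ → List (ℕ × List ℕ)
select [] = []
select (x ∷ xs) = (x , xs) ∷ map (λ (y , rest) → y , x ∷ rest) (select xs)

select-sound : ∀ {y rest} xs → (y , rest) ∈ select xs → xs ↭ y ∷ rest
select-sound (x ∷ xs) (here refl) = ↭-refl
select-sound (x ∷ xs) (there p∈) with ∈-map⁻ _ p∈
... | (y , rest) , p∈′ , refl = ↭-trans (prep x (select-sound xs p∈′)) (swap x y ↭-refl)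

select-complete : ∀ y as bs → (y , as ++ bs) ∈ select (as ++ y ∷ bs)
select-complete y [] bs = here refl
select-complete y (a ∷ as) bs = there (∈-map⁺ (λ (y , rest) → y , a ∷ rest) (select-complete y as bs))

arrangements : ℕ → List ℕ → List (List ℕ)
arrangements zero _ = [] ∷ []
arrangements (suc k) ys = concatMap (λ (y , rest) → map (y ∷_) (arrangements k rest)) (select ys)

arrangements-sound : ∀ k ys {xs} → length ys ≡ k → xs ∈ arrangements k ys → xs ↭ ys
arrangements-sound zero [] _ (here refl) = ↭-refl
arrangements-sound (suc k) ys len xs∈ with find (∈-concatMap⁻ _ {xs = select ys} xs∈)
... | (y , rest) , p∈ , xs∈′ with ∈-map⁻ (y ∷_) xs∈′
... | xs′ , xs′∈ , refl = ↭-trans (prep y (arrangements-sound k rest len′ xs′∈)) (↭-sym (select-sound ys p∈))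
  where len′ = suc-injective (trans (sym (↭-length (select-sound ys p∈))) len)

arrangements-complete : ∀ k ys {xs} → length ys ≡ k → xs ↭ ys → xs ∈ arrangements k ys
arrangements-complete zero [] _ xs↭[] rewrite ↭-empty-inv xs↭[] = here refl
arrangements-complete (suc k) ys {[]} len []↭ys = ⊥-elim (0≢1+n (trans (↭-length []↭ys) len))
arrangements-complete (suc k) ys {x ∷ xs} len x∷xs↭ys with ∈-∃++ (∈-resp-↭ x∷xs↭ys (here refl))
... | as , bs , refl =
  ∈-concatMap⁺ _ {xs = select (as ++ x ∷ bs)} (lose (select-complete x as bs)
    (∈-map⁺ (x ∷_) (arrangements-complete k (as ++ bs) (suc-injective (trans (sym (length-++-sucʳ as x bs)) len))
                                          (drop-mid [] as x∷xs↭ys))))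

allPerms : ℕ → List (List ℕ)
allPerms n = arrangements n (range n)

entries∈allPerms : ∀ π {n} → size π ≡ n → entries π ∈ allPerms n
entries∈allPerms π {n} refl = arrangements-complete n (range n) (length-range n) (isPerm π)

∈allPerms⇒Perm : ∀ {l n} → l ∈ allPerms n → Σ Perm λ ρ → entries ρ ≡ l × size ρ ≡ n
∈allPerms⇒Perm {l} {n} l∈ = mkPerm l (subst (λ m → l ↭ range m) (sym size≡) l↭) , refl , size≡
  where
  l↭ = arrangements-sound n (range n) (length-range n) l∈
  size≡ = trans (↭-length l↭) (length-range n)

_⇔-dec_ : {P Q : Set} → Dec P → Dec Q → Dec (P ⇔ Q)
p? ⇔-dec q? = map′ (λ (to , from) → mk⇔ to from) (λ p⇔q → Equivalence.to p⇔q , Equivalence.from p⇔q)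
                   ((p? →-dec q?) ×-dec (q? →-dec p?))

ordIso? : (xs ys : List ℕ) → Dec (OrdIso xs ys)
ordIso? [] [] = yes tt
ordIso? [] (_ ∷ _) = no λ ()
ordIso? (_ ∷ _) [] = no λ ()
ordIso? (x ∷ xs) (y ∷ ys) =
  Pointwise.decidable (λ x′ y′ → ((x <? x′) ⇔-dec (y <? y′)) ×-dec ((x′ <? x) ⇔-dec (y′ <? y))) xs ys
  ×-dec ordIso? xs ys

∃-⊆? : {P : List ℕ → Set} → (∀ ys → Dec (P ys)) → ∀ xs → Dec (Σ (List ℕ) λ ys → ys ⊆ xs × P ys)
∃-⊆? P? [] = map′ (λ p → [] , [] , p) (λ { ([] , [] , p) → p }) (P? [])
∃-⊆? P? (x ∷ xs) = map′ keep-or-skip split (∃-⊆? (λ ys → P? (x ∷ ys)) xs ⊎-dec ∃-⊆? P? xs)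
  where
  keep-or-skip : _ → _
  keep-or-skip (inj₁ (ys , ys⊆ , p)) = x ∷ ys , refl ∷ ys⊆ , p
  keep-or-skip (inj₂ (ys , ys⊆ , p)) = ys , x ∷ʳ ys⊆ , p
  split : _ → _
  split (ys , (.x ∷ʳ ys⊆) , p) = inj₂ (ys , ys⊆ , p)
  split ((.x ∷ ys) , (refl ∷ ys⊆) , p) = inj₁ (ys , ys⊆ , p)

profile : ℕ → List ℕ → List Bool
profile k xs = map (λ l → does (∃-⊆? (ordIso? l) xs)) (allPerms k)

SameDeck⇒profile≡ : ∀ k π σ → SameDeck (suc k) π σ → profile k (entries π) ≡ profile k (entries σ)
SameDeck⇒profile≡ k π σ deck = map-cong-local (All.tabulate same-bit)
  where
  same-bit : ∀ {l} → l ∈ allPerms k → does (∃-⊆? (ordIso? l) (entries π)) ≡ does (∃-⊆? (ordIso? l) (entries σ))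
  same-bit {l} l∈ with ∈allPerms⇒Perm l∈
  ... | ρ , refl , size≡ = does-⇔ (deck ρ (cong suc size≡)) (∃-⊆? (ordIso? l) (entries π)) (∃-⊆? (ordIso? l) (entries σ))

-- Reconstruction from the deck

DeckDetermines : List (List ℕ × List Bool) → Set
DeckDetermines T = All (λ (x , d) → All (λ (y , e) → x ∉ Rlist → d ≡ e → x ≡ y) T) T

-- The table is a parameter so that each profile is evaluated only once.
deckDetermines? : ∀ T → Dec (DeckDetermines T)
deckDetermines? T =
  all? (λ (x , d) → all? (λ (y , e) → ¬? (x ∈ₗ? Rlist) →-dec (≡-dec Bool._≟_ d e →-dec ≡-dec _≟_ x y)) T) T

deckTable : ℕ → List (List ℕ × List Bool)
deckTable k = map (λ x → x , profile k x) (allPerms (suc k))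

small-decks-determine : ∀ k → k ≤ 4 → DeckDetermines (deckTable k)
small-decks-determine 0 _ = from-yes (deckDetermines? (deckTable 0))
small-decks-determine 1 _ = from-yes (deckDetermines? (deckTable 1))
small-decks-determine 2 _ = from-yes (deckDetermines? (deckTable 2))
small-decks-determine 3 _ = from-yes (deckDetermines? (deckTable 3))
small-decks-determine 4 _ = from-yes (deckDetermines? (deckTable 4))
small-decks-determine (suc (suc (suc (suc (suc _))))) (s≤s (s≤s (s≤s (s≤s ()))))

reconstruct-small : ∀ k → k ≤ 4 → ∀ π σ → size π ≡ suc k → size σ ≡ suc k → ¬ InR π →
  SameDeck (suc k) π σ → entries π ≡ entries σ
reconstruct-small k k≤4 π σ lπ lσ π∉R deck =
  All.lookup (All.lookup (small-decks-determine k k≤4) (row π lπ)) (row σ lσ) π∉R (SameDeck⇒profile≡ k π σ deck)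
  where
  row : ∀ τ → size τ ≡ suc k → (entries τ , profile k (entries τ)) ∈ deckTable k
  row τ lτ = ∈-map⁺ (λ x → x , profile k x) (entries∈allPerms τ lτ)

reconstruct-step : ∀ j → 1 ≤ j →
  (∀ σ₁ σ₂ → size σ₁ ≡ suc j → size σ₂ ≡ suc j → SameDeck (suc j) σ₁ σ₂ → entries σ₁ ≡ entries σ₂) →
  ∀ π σ → size π ≡ suc (suc j) → size σ ≡ suc (suc j) → SameDeck (suc (suc j)) π σ → entries π ≡ entries σ
reconstruct-step j 1≤j IH π@(mkPerm (x ∷ xs) _) σ@(mkPerm (y ∷ ys) _) lπ lσ deck =
  ≅⇒≡ π σ (reassemble dπ dσ (trans lπ (sym lσ)) (subst (3 ≤_) (sym lπ) (s≤s (s≤s 1≤j)))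
             (by firstEntry) (by lastEntry) (by largestEntry))
  where
  dπ = Distinct-entries π
  dσ = Distinct-entries σ
  by : (D : EntryDeletion) → EntryDeletion.del D (x ∷ xs) ≅ EntryDeletion.del D (y ∷ ys)
  by D = del-≅-by-induction D j IH lπ lσ dπ dσ
           (≼⇒PatternsIncluded {π} {σ} (suc j) λ ρ len → Equivalence.to (deck ρ (cong suc len)))
           (≼⇒PatternsIncluded {σ} {π} (suc j) λ ρ len → Equivalence.from (deck ρ (cong suc len)))

R-short : All (λ r → length r ≤ 4) Rlist
R-short = from-yes (all? (λ r → length r ≤? 4) Rlist)

reconstruct-large : ∀ n → 4 ≤ n → ∀ π σ → size π ≡ suc n → size σ ≡ suc n → SameDeck (suc n) π σ →
  entries π ≡ entries σ
reconstruct-large n 4≤n with m≤n⇒m<n∨m≡n 4≤n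
... | inj₂ refl = λ π σ lπ lσ → reconstruct-small 4 ≤-refl π σ lπ lσ
                    λ π∈R → ≤⇒≯ (All.lookup R-short π∈R) (≤-reflexive (sym lπ))
reconstruct-large (suc n) _ | inj₁ (s≤s 4≤n) = reconstruct-step n (≤-trans (s≤s z≤n) 4≤n) (reconstruct-large n 4≤n)

reconstruct : ∀ n π σ → size π ≡ n → size σ ≡ n → ¬ InR π → SameDeck n π σ → entries π ≡ entries σ
reconstruct zero (mkPerm [] _) (mkPerm [] _) _ _ _ _ = refl
reconstruct (suc k) π σ lπ lσ π∉R with k ≤? 4
... | yes k≤4 = reconstruct-small k k≤4 π σ lπ lσ π∉R
... | no k≰4 = reconstruct-large k (<⇒≤ (≰⇒> k≰4)) π σ lπ lσ

-- Poset isomorphisms between pattern classes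

module _ {A B : Perm → Set} (f : PosetIso A B) where

  fun-≼ : ∀ {σ π} (a : A σ) (b : A π) → σ ≼ π → fun f σ a ≼ fun f π b
  fun-≼ a b = Equivalence.to (order f _ _ a b)

  fun-≼⁻ : ∀ {σ π} (a : A σ) (b : A π) → fun f σ a ≼ fun f π b → σ ≼ π
  fun-≼⁻ a b = Equivalence.from (order f _ _ a b)

  fun-resp : ∀ {σ π} (a : A σ) (b : A π) → entries σ ≡ entries π → entries (fun f σ a) ≡ entries (fun f π b)
  fun-resp {σ} {π} a b σ≡π =
    ≼-antisym {fun f σ a} {fun f π b} (fun-≼ a b (≡⇒≼ σ π σ≡π)) (fun-≼ b a (≡⇒≼ π σ (sym σ≡π)))

  fun-injective : ∀ {σ π} (a : A σ) (b : A π) → entries (fun f σ a) ≡ entries (fun f π b) → entries σ ≡ entries π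
  fun-injective {σ} {π} a b fσ≡fπ =
    ≼-antisym {σ} {π} (fun-≼⁻ a b (≡⇒≼ (fun f σ a) (fun f π b) fσ≡fπ))
                      (fun-≼⁻ b a (≡⇒≼ (fun f π b) (fun f σ a) (sym fσ≡fπ)))

  inverse : PosetIso B A
  inverse = record
    { fun     = λ τ b → proj₁ (surject f τ b)
    ; fun∈    = λ τ b → proj₁ (proj₂ (surject f τ b))
    ; order   = λ τ τ′ b b′ →
        let π , a , fπ≡τ = surject f τ b
            π′ , a′ , fπ′≡τ′ = surject f τ′ b′
        in mk⇔ (λ τ≼τ′ → fun-≼⁻ a a′ (≼-respˡ {τ} {fun f π a} {fun f π′ a′} (sym fπ≡τ)
                                        (≼-respʳ {τ} {τ′} {fun f π′ a′} (sym fπ′≡τ′) τ≼τ′)))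
               (λ π≼π′ → ≼-respˡ {fun f π a} {τ} {τ′} fπ≡τ
                           (≼-respʳ {fun f π a} {fun f π′ a′} {τ′} fπ′≡τ′ (fun-≼ a a′ π≼π′)))
    ; surject = λ π a →
        let _ , a′ , fπ′≡fπ = surject f (fun f π a) (fun∈ f π a)
        in fun f π a , fun∈ f π a , fun-injective a′ a fπ′≡fπ
    }

  size-≤-fun : IsPatternClass A → ∀ n π (a : A π) → size π ≡ n → n ≤ size (fun f π a)
  size-≤-fun _ zero _ _ _ = z≤n
  size-≤-fun pA (suc k) π a size≡ =
    let ρ , ρ≼π , ρ-size = pattern-of-size π k size≡
        aρ = pA ρ π ρ≼π a
        fρ≼fπ = fun-≼ aρ a ρ≼π
        fρ≢fπ : entries (fun f ρ aρ) ≢ entries (fun f π a)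
        fρ≢fπ fρ≡fπ = 1+n≢n (trans (sym size≡) (trans (cong length (sym (fun-injective aρ a fρ≡fπ))) ρ-size))
    in ≤-trans (s≤s (size-≤-fun pA k ρ aρ ρ-size))
         (≤∧≢⇒< (size-≼ {fun f ρ aρ} {fun f π a} fρ≼fπ) (fρ≢fπ ∘ ≼-same-size {fun f ρ aρ} {fun f π a} fρ≼fπ))

size-fun : ∀ {A B} → IsPatternClass A → IsPatternClass B → (f : PosetIso A B) → ∀ π (a : A π) → size (fun f π a) ≡ size π
size-fun pA pB f π a =
  ≤-antisym (subst (size (fun f π a) ≤_) (cong length π′≡π) (size-≤-fun (inverse f) pB _ (fun f π a) b refl))
            (size-≤-fun f pA _ π a refl)
  where
  b = fun∈ f π a
  π′≡π : entries (fun (inverse f) (fun f π a) b) ≡ entries π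
  π′≡π = fun-injective f (fun∈ (inverse f) (fun f π a) b) a (proj₂ (proj₂ (surject f (fun f π a) b)))

module _ {A B : Perm → Set} (pA : IsPatternClass A) (f g : PosetIso A B) where

  ≼-transfer : ∀ {π π′} (a : A π) (a′ : A π′) → entries (fun f π a) ≡ entries (fun g π′ a′) →
    (∀ ρ (aρ : A ρ) → size ρ < size π → entries (fun f ρ aρ) ≡ entries (fun g ρ aρ)) →
    ∀ ρ → size ρ < size π → ρ ≼ π → ρ ≼ π′
  ≼-transfer {π} {π′} a a′ fπ≡gπ′ agree ρ ρ<π ρ≼π =
    fun-≼⁻ g aρ a′ (≼-respˡ {fun f ρ aρ} {fun g ρ aρ} {fun g π′ a′} (agree ρ aρ ρ<π)
                    (≼-respʳ {fun f ρ aρ} {fun f π a} {fun g π′ a′} fπ≡gπ′ (fun-≼ f aρ a ρ≼π)))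
    where aρ = pA ρ π ρ≼π a

mainTheorem9 : (A B : Perm → Set) → IsPatternClass A → IsPatternClass B →
    (f g : PosetIso A B) →
    (∀ π (a : A π) → InR π → entries (fun f π a) ≡ entries (fun g π a)) →
    ∀ π (a : A π) → entries (fun f π a) ≡ entries (fun g π a)
mainTheorem9 A B pA pB f g agree-on-R π a = <-rec P step (size π) π a refl
  where
  P : ℕ → Set
  P n = ∀ π (a : A π) → size π ≡ n → entries (fun f π a) ≡ entries (fun g π a)
  step : ∀ n → (∀ {m} → m < n → P m) → P n
  step n IH π a refl with entries π ∈ₗ? Rlist
  ... | yes π∈R = agree-on-R π a π∈R
  ... | no π∉R = trans (sym gπ′≡fπ) (fun-resp g a′ a (sym π≡π′))
    where
    agree : ∀ ρ (aρ : A ρ) → size ρ < size π → entries (fun f ρ aρ) ≡ entries (fun g ρ aρ)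
    agree ρ aρ ρ<π = IH ρ<π ρ aρ refl
    preimage = surject g (fun f π a) (fun∈ f π a)
    π′ = proj₁ preimage
    a′ = proj₁ (proj₂ preimage)
    gπ′≡fπ = proj₂ (proj₂ preimage)
    same-size : size π′ ≡ size π
    same-size = trans (sym (size-fun pA pB g π′ a′)) (trans (cong length gπ′≡fπ) (size-fun pA pB f π a))
    π≡π′ : entries π ≡ entries π′
    π≡π′ = reconstruct (size π) π π′ refl same-size π∉R λ ρ len →
      mk⇔ (≼-transfer pA f g a a′ (sym gπ′≡fπ) agree ρ (≤-reflexive len))
          (≼-transfer pA g f a′ a gπ′≡fπ (λ ρ aρ ρ< → sym (agree ρ aρ (subst (size ρ <_) same-size ρ<)))
                      ρ (subst (suc (size ρ) ≤_) (sym same-size) (≤-reflexive len)))
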